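{- Let $p$ be the partially ordered pattern of length $4$ on the labels $\{1,2,3,4\}$ whose only relation is $1>4$. Let $a(n)$ be the number of $n$-permutations avoiding $p$. Then $a(0)=a(1)=1$, $a(2)=2$, $a(3)=6$, and for $n\geq 4$, $a(n)=a(n-1)+a(n-2)+3a(n-3)+a(n-4)$. Also, $$\sum_{n\geq 0}a(n)x^n=\frac{1}{1-x-x^2-3x^3-x^4}.$$
   Context: An $n$-permutation is a permutation $\pi=\pi_1\cdots\pi_n$ of $\{1,\dots,n\}$ written in one-line notation (for $n=0$ there is exactly one, the empty permutation). A partially ordered pattern (POP) $p$ of length $k$ is a partial order $<_P$ on the label set $\{1,\dots,k\}$. An occurrence of $p$ in $\pi$ is a subsequence $\pi_{i_1}\pi_{i_2}\cdots\pi_{i_k}$ with $1\leq i_1<\cdots<i_k\leq n$ such that $\pi_{i_j}<\pi_{i_m}$ whenever $j<_P m$ (no condition is imposed on pairs of incomparable labels). A permutation avoids $p$ if it contains no occurrence of $p$. -}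

module Defs where

open import Data.Nat using (ℕ; zero; suc; _<_; _∸_)
open import Data.Fin using (Fin; toℕ) renaming (zero to fz; suc to fs)
import Data.Fin as F
open import Data.Vec using (Vec; lookup)
open import Data.List using (List; length)
open import Data.List.Relation.Unary.Unique.Propositional using (Unique)
open import Data.List.Membership.Propositional using (_∈_)
open import Data.Product using (Σ; _×_; ∃)
open import Data.Integer using (ℤ; +_; -_) renaming (_+_ to _+ℤ_; _*_ to _*ℤ_)
open import Relation.Binary.PropositionalEquality using (_≡_)
open import Relation.Nullary using (¬_)
open import Function.Bundles using (_⇔_)

-- An n-permutation in one-line notation: a vector π₁ … πₙ of values in
-- Fin n (values 0,…,n-1 stand for 1,…,n) with pairwise distinct entries.
IsPerm : ∀ {n} → Vec (Fin n) n → Set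
IsPerm {n} π = ∀ (i j : Fin n) → lookup π i ≡ lookup π j → i ≡ j

-- A partially ordered pattern of length k: the strict order relation
-- j <_P m on the labels Fin k (label j+1 is represented by j : Fin k).
POP : ℕ → Set₁
POP k = Fin k → Fin k → Set

Occurrence : ∀ {k n} → POP k → Vec (Fin n) n → Set
Occurrence {k} {n} p π =
  Σ (Fin k → Fin n) λ ι →
    (∀ (j m : Fin k) → j F.< m → ι j F.< ι m) ×
    (∀ (j m : Fin k) → p j m → lookup π (ι j) F.< lookup π (ι m))

Avoids : ∀ {k n} → POP k → Vec (Fin n) n → Set
Avoids p π = ¬ Occurrence p π

NumAvoiders : ∀ {k} → POP k → ℕ → ℕ → Set
NumAvoiders p n c =
  Σ (List (Vec (Fin n) n)) λ L →
    Unique L ×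
    (∀ π → (π ∈ L) ⇔ (IsPerm π × Avoids p π)) ×
    length L ≡ c

-- The pattern of the theorem: labels 1,2,3,4 (= 0,1,2,3 : Fin 4),
-- whose only relation is 1 > 4, i.e. 4 <_P 1.
data P14 : Fin 4 → Fin 4 → Set where
  four<one : P14 (fs (fs (fs fz))) fz

Series : Set
Series = ℕ → ℤ

sumTo : ℕ → (ℕ → ℤ) → ℤ
sumTo zero f = f zero
sumTo (suc n) f = sumTo n f +ℤ f (suc n)

_⊛_ : Series → Series → Series
(f ⊛ g) n = sumTo n (λ i → f i *ℤ g (n ∸ i))

oneS : Series
oneS zero = + 1
oneS (suc _) = + 0

denom : Series
denom 0 = + 1
denom 1 = - (+ 1)
denom 2 = - (+ 1)
denom 3 = - (+ 3)
denom 4 = - (+ 1)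
denom _ = + 0

ogf : (ℕ → ℕ) → Series
ogf a n = + (a n)

-- An occurrence of the pattern is a pair of positions i < l with l ≥ i + 3 and π l < π i, so
-- π avoids it exactly when entries at distance at least three increase. Such a permutation is a
-- direct sum b ⊕ σ whose first block b is one of 1, 21, 321, 231, 312, 2413 (found by following
-- where the values 0, 1, 2, 3 can sit), and σ is again an avoider. Gluing each block of length k
-- to the avoiders of length n - k therefore lists the avoiders of length n without repetition,
-- which gives a(n) = a(n-1) + a(n-2) + 3a(n-3) + a(n-4); multiplying the generating function by
-- 1 - x - x² - 3x³ - x⁴ cancels every coefficient beyond the initial ones.
module Submission where

open import Defs
open import Data.Nat using (ℕ; zero; suc; _+_; _*_; _∸_; _≤_; _<_; _≰_; z≤n; s≤s; s≤s⁻¹; _≤?_)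
open import Data.Nat.Properties
  using ( ≤-refl; ≤-reflexive; ≤-trans; <⇒≤; <-irrefl; ≮⇒≥; ≰⇒>; <⇒≱; 1+n≰n; n≤1+n; m≤n⇒m≤1+n
        ; m≤m+n; m≤n+m; m<n+m; +-cancelˡ-≤; +-monoʳ-≤; m+n∸n≡m; +-∸-assoc; m<n⇒0<n∸m
        ; +-commutativeSemigroup)
open import Data.Nat.Induction using (<-rec)
open import Data.Nat.Tactic.RingSolver using () renaming (solve-∀ to ℕ-solve-∀)
open import Data.Integer using (ℤ; -_) renaming (+_ to pos; _+_ to _+ℤ_; _*_ to _*ℤ_)
import Data.Integer.Properties as ℤ
open import Data.Integer.Tactic.RingSolver using (solve-∀)
open import Data.Fin as F using (Fin; toℕ; _↑ˡ_; _↑ʳ_; punchOut)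
open import Data.Fin.Patterns
import Data.Fin.Properties as FP
open import Data.Vec as V using (Vec; []; _∷_; lookup)
open import Data.Vec.Properties using (≡-dec; lookup-map; lookup-++ˡ; lookup-++ʳ; lookup∘tabulate)
open import Data.Vec.Relation.Binary.Pointwise.Extensional using (ext; Pointwise-≡⇒≡)
open import Data.List as L using (List; []; _∷_; length)
open import Data.List.Properties using (length-++; length-map)
open import Data.List.Membership.Propositional using (_∈_)
open import Data.List.Membership.Propositional.Properties
  using (∈-cartesianProductWith⁺; ∈-cartesianProductWith⁻; ∈-++⁺ˡ; ∈-++⁺ʳ)
open import Data.List.Membership.Propositional.Properties.WithK using (unique∧set⇒bag)
open import Data.List.Relation.Unary.Any using (here; there)
open import Data.List.Relation.Unary.All as All using (All; []; _∷_)
import Data.List.Relation.Unary.All.Properties as All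
open import Data.List.Relation.Unary.AllPairs using ([]; _∷_)
open import Data.List.Relation.Unary.Unique.Propositional using (Unique)
import Data.List.Relation.Unary.Unique.Propositional.Properties as Unique
import Data.List.Relation.Unary.Unique.DecPropositional as UniqueDec
open import Data.List.Relation.Binary.Disjoint.Propositional using (Disjoint)
open import Data.List.Relation.Binary.BagAndSetEquality using (∼bag⇒↭)
open import Data.List.Relation.Binary.Permutation.Propositional.Properties using (↭-length)
open import Data.Product using (Σ; ∃; _×_; _,_; proj₁; proj₂)
open import Function using (_∘_)
open import Function.Bundles using (_⇔_; mk⇔; Equivalence)
import Function.Properties.Equivalence as ⇔
open import Relation.Nullary using (Dec; yes; no; contradiction)
open import Relation.Nullary.Decidable using (True; _×-dec_; _→-dec_; map′; toWitness)
open import Relation.Binary.PropositionalEquality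
  using (_≡_; _≢_; refl; sym; trans; cong; cong₂; subst; subst₂; module ≡-Reasoning)
open import Algebra.Properties.CommutativeSemigroup +-commutativeSemigroup using (x∙yz≈y∙xz)

FarIncreasing : ∀ {n} → Vec (Fin n) n → Set
FarIncreasing {n} π = ∀ (i l : Fin n) → 3 + toℕ i ≤ toℕ l → lookup π i F.≤ lookup π l

record FarIncreasingPerm {n} (π : Vec (Fin n) n) : Set where
  constructor _,_
  field
    isPerm        : IsPerm π
    farIncreasing : FarIncreasing π
open FarIncreasingPerm

<-chain₄ : ∀ {n} {ι : Fin 4 → Fin n} → ι 0F F.< ι 1F → ι 1F F.< ι 2F → ι 2F F.< ι 3F →
           ∀ j m → j F.< m → ι j F.< ι m
<-chain₄ p q r 0F 1F _ = p
<-chain₄ p q r 0F 2F _ = FP.<-trans p q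
<-chain₄ p q r 0F 3F _ = FP.<-trans p (FP.<-trans q r)
<-chain₄ p q r 1F 2F _ = q
<-chain₄ p q r 1F 3F _ = FP.<-trans q r
<-chain₄ p q r 2F 3F _ = r
<-chain₄ _ _ _ _ 0F ()
<-chain₄ _ _ _ 1F 1F (s≤s ())
<-chain₄ _ _ _ 2F 1F (s≤s ())
<-chain₄ _ _ _ 3F 1F (s≤s ())
<-chain₄ _ _ _ 2F 2F (s≤s (s≤s ()))
<-chain₄ _ _ _ 3F 2F (s≤s (s≤s ()))
<-chain₄ _ _ _ 3F 3F (s≤s (s≤s (s≤s ())))

farIncreasing⇒avoids : ∀ {n} {π : Vec (Fin n) n} → FarIncreasing π → Avoids P14 π
farIncreasing⇒avoids far (ι , increasing , respects) =
  <⇒≱ (respects 3F 0F four<one) (far (ι 0F) (ι 3F) spread)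
  where
  spread : 3 + toℕ (ι 0F) ≤ toℕ (ι 3F)
  spread = ≤-trans (s≤s (s≤s (increasing 0F 1F (s≤s z≤n))))
             (≤-trans (s≤s (increasing 1F 2F (s≤s (s≤s z≤n))))
                      (increasing 2F 3F (s≤s (s≤s (s≤s z≤n)))))

-- An occurrence is found at positions i, l - 2, l - 1, l.
avoids⇒farIncreasing : ∀ {n} {π : Vec (Fin n) n} → Avoids P14 π → FarIncreasing π
avoids⇒farIncreasing _ _ 0F ()
avoids⇒farIncreasing _ _ 1F (s≤s ())
avoids⇒farIncreasing avoid i l@(F.suc (F.suc l₂)) spread =
  ≮⇒≥ λ πl<πi → avoid (ι , <-chain₄ i<l₂ l₂<l₁ l₁<l , λ { .3F .0F four<one → πl<πi })
  where
  ι : Fin 4 → Fin _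
  ι 0F = i
  ι 1F = F.inject₁ (F.inject₁ l₂)
  ι 2F = F.inject₁ (F.suc l₂)
  ι 3F = l
  i<l₂ : ι 0F F.< ι 1F
  i<l₂ = subst (toℕ i <_) (sym (trans (FP.toℕ-inject₁ _) (FP.toℕ-inject₁ l₂))) (s≤s⁻¹ (s≤s⁻¹ spread))
  l₂<l₁ : ι 1F F.< ι 2F
  l₂<l₁ = s≤s (≤-reflexive (FP.toℕ-inject₁ (F.inject₁ l₂)))
  l₁<l : ι 2F F.< ι 3F
  l₁<l = s≤s (s≤s (≤-reflexive (FP.toℕ-inject₁ l₂)))

avoids⇔farIncreasing : ∀ {n} {π : Vec (Fin n) n} → Avoids P14 π ⇔ FarIncreasing π
avoids⇔farIncreasing {π = π} = mk⇔ (avoids⇒farIncreasing {π = π}) (farIncreasing⇒avoids {π = π})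

isPerm⇒surjective : ∀ {n} {π : Vec (Fin n) n} → IsPerm π → ∀ v → ∃ λ i → lookup π i ≡ v
isPerm⇒surjective {π = π} perm v with FP.any? (λ i → lookup π i FP.≟ v)
... | yes hit = hit
isPerm⇒surjective {suc n} {π} perm v | no miss =
  contradiction (FP.injective⇒≤ punched-injective) (<-irrefl refl)
  where
  avoids-v : ∀ i → v ≢ lookup π i
  avoids-v i v≡πi = miss (i , sym v≡πi)
  punched-injective : ∀ {i j} → punchOut (avoids-v i) ≡ punchOut (avoids-v j) → i ≡ j
  punched-injective eq = perm _ _ (FP.punchOut-injective (avoids-v _) (avoids-v _) eq)

isPerm? : ∀ {n} (π : Vec (Fin n) n) → Dec (IsPerm π)
isPerm? π = FP.all? λ i → FP.all? λ j → (lookup π i FP.≟ lookup π j) →-dec (i FP.≟ j)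

farIncreasing? : ∀ {n} (π : Vec (Fin n) n) → Dec (FarIncreasing π)
farIncreasing? π = FP.all? λ i → FP.all? λ l → (3 + toℕ i ≤? toℕ l) →-dec (lookup π i FP.≤? lookup π l)

farIncreasingPerm? : ∀ {n} (π : Vec (Fin n) n) → Dec (FarIncreasingPerm π)
farIncreasingPerm? π = map′ (λ (perm , far) → perm , far) (λ fip → isPerm fip , farIncreasing fip)
  (isPerm? π ×-dec farIncreasing? π)

infixr 5 _⊕_
_⊕_ : ∀ {k m} → Vec (Fin k) k → Vec (Fin m) m → Vec (Fin (k + m)) (k + m)
_⊕_ {k} {m} b σ = V.map (_↑ˡ m) b V.++ V.map (k ↑ʳ_) σ

data Split (k m : ℕ) : Fin (k + m) → Set where
  left  : (i : Fin k) → Split k m (i ↑ˡ m)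
  right : (j : Fin m) → Split k m (k ↑ʳ j)

split : ∀ k m (x : Fin (k + m)) → Split k m x
split zero    m x        = right x
split (suc k) m 0F       = left 0F
split (suc k) m (F.suc x) with split k m x
... | left i  = left (F.suc i)
... | right j = right j

toℕ-↑ˡ<toℕ-↑ʳ : ∀ {k m} (i : Fin k) (j : Fin m) → toℕ (i ↑ˡ m) < toℕ (k ↑ʳ j)
toℕ-↑ˡ<toℕ-↑ʳ {k} {m} i j =
  subst₂ _<_ (sym (FP.toℕ-↑ˡ i m)) (sym (FP.toℕ-↑ʳ k j)) (≤-trans (FP.toℕ<n i) (m≤m+n k (toℕ j)))

↑ˡ≢↑ʳ : ∀ {k m} (i : Fin k) (j : Fin m) → i ↑ˡ m ≢ k ↑ʳ j
↑ˡ≢↑ʳ i j eq = <-irrefl (cong toℕ eq) (toℕ-↑ˡ<toℕ-↑ʳ i j)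

↑ˡ-≤ : ∀ {k} m {x y : Fin k} → x ↑ˡ m F.≤ y ↑ˡ m ⇔ x F.≤ y
↑ˡ-≤ m {x} {y} = mk⇔ (subst₂ _≤_ (FP.toℕ-↑ˡ x m) (FP.toℕ-↑ˡ y m))
                     (subst₂ _≤_ (sym (FP.toℕ-↑ˡ x m)) (sym (FP.toℕ-↑ˡ y m)))

↑ʳ-≤ : ∀ k {m} {x y : Fin m} → k ↑ʳ x F.≤ k ↑ʳ y ⇔ x F.≤ y
↑ʳ-≤ k {x = x} {y} = mk⇔ (λ le → +-cancelˡ-≤ k _ _ (subst₂ _≤_ (FP.toℕ-↑ʳ k x) (FP.toℕ-↑ʳ k y) le))
                        (λ le → subst₂ _≤_ (sym (FP.toℕ-↑ʳ k x)) (sym (FP.toℕ-↑ʳ k y)) (+-monoʳ-≤ k le))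

↑ˡ-spread : ∀ {k} m (i i′ : Fin k) → 3 + toℕ (i ↑ˡ m) ≤ toℕ (i′ ↑ˡ m) ⇔ 3 + toℕ i ≤ toℕ i′
↑ˡ-spread m i i′ = mk⇔ (subst₂ (λ a c → 3 + a ≤ c) (FP.toℕ-↑ˡ i m) (FP.toℕ-↑ˡ i′ m))
                       (subst₂ (λ a c → 3 + a ≤ c) (sym (FP.toℕ-↑ˡ i m)) (sym (FP.toℕ-↑ˡ i′ m)))

↑ʳ-spread : ∀ k {m} (j j′ : Fin m) → 3 + toℕ (k ↑ʳ j) ≤ toℕ (k ↑ʳ j′) ⇔ 3 + toℕ j ≤ toℕ j′
↑ʳ-spread k j j′ = mk⇔
  (λ le → +-cancelˡ-≤ k _ _ (subst₂ _≤_ (shift j) (FP.toℕ-↑ʳ k j′) le))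
  (λ le → subst₂ _≤_ (sym (shift j)) (sym (FP.toℕ-↑ʳ k j′)) (+-monoʳ-≤ k le))
  where
  shift : ∀ j → 3 + toℕ (k ↑ʳ j) ≡ k + (3 + toℕ j)
  shift j = trans (cong (3 +_) (FP.toℕ-↑ʳ k j)) (x∙yz≈y∙xz 3 k (toℕ j))

module _ {k m} (b : Vec (Fin k) k) (σ : Vec (Fin m) m) where

  lookup-⊕ˡ : ∀ i → lookup (b ⊕ σ) (i ↑ˡ m) ≡ lookup b i ↑ˡ m
  lookup-⊕ˡ i = trans (lookup-++ˡ (V.map (_↑ˡ m) b) _ i) (lookup-map i (_↑ˡ m) b)

  lookup-⊕ʳ : ∀ j → lookup (b ⊕ σ) (k ↑ʳ j) ≡ k ↑ʳ lookup σ j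
  lookup-⊕ʳ j = trans (lookup-++ʳ (V.map (_↑ˡ m) b) _ j) (lookup-map j (k ↑ʳ_) σ)

  ⊕-isPerm : IsPerm b → IsPerm σ → IsPerm (b ⊕ σ)
  ⊕-isPerm perm-b perm-σ x y eq with split k m x | split k m y
  ... | left i  | left i′  = cong (_↑ˡ m) (perm-b i i′ (FP.↑ˡ-injective m _ _
          (trans (sym (lookup-⊕ˡ i)) (trans eq (lookup-⊕ˡ i′)))))
  ... | left i  | right j′ = contradiction (trans (sym (lookup-⊕ˡ i)) (trans eq (lookup-⊕ʳ j′))) (↑ˡ≢↑ʳ _ _)
  ... | right j | left i′  = contradiction (trans (sym (lookup-⊕ˡ i′)) (trans (sym eq) (lookup-⊕ʳ j))) (↑ˡ≢↑ʳ _ _)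
  ... | right j | right j′ = cong (k ↑ʳ_) (perm-σ j j′ (FP.↑ʳ-injective k _ _
          (trans (sym (lookup-⊕ʳ j)) (trans eq (lookup-⊕ʳ j′)))))

  ⊕-farIncreasing : FarIncreasing b → FarIncreasing σ → FarIncreasing (b ⊕ σ)
  ⊕-farIncreasing far-b far-σ x y spread with split k m x | split k m y
  ... | left i  | left i′  = subst₂ F._≤_ (sym (lookup-⊕ˡ i)) (sym (lookup-⊕ˡ i′))
          (Equivalence.from (↑ˡ-≤ m) (far-b i i′ (Equivalence.to (↑ˡ-spread m i i′) spread)))
  ... | left i  | right j′ = subst₂ F._≤_ (sym (lookup-⊕ˡ i)) (sym (lookup-⊕ʳ j′))
          (<⇒≤ (toℕ-↑ˡ<toℕ-↑ʳ _ _))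
  ... | right j | left i′  = contradiction spread (<⇒≱ (≤-trans (toℕ-↑ˡ<toℕ-↑ʳ i′ j) (m≤n+m _ 3)))
  ... | right j | right j′ = subst₂ F._≤_ (sym (lookup-⊕ʳ j)) (sym (lookup-⊕ʳ j′))
          (Equivalence.from (↑ʳ-≤ k) (far-σ j j′ (Equivalence.to (↑ʳ-spread k j j′) spread)))

  ⊕-isPerm⁻ʳ : IsPerm (b ⊕ σ) → IsPerm σ
  ⊕-isPerm⁻ʳ perm j j′ eq = FP.↑ʳ-injective k j j′
    (perm _ _ (trans (lookup-⊕ʳ j) (trans (cong (k ↑ʳ_) eq) (sym (lookup-⊕ʳ j′)))))

  ⊕-farIncreasing⁻ʳ : FarIncreasing (b ⊕ σ) → FarIncreasing σ
  ⊕-farIncreasing⁻ʳ far j j′ spread = Equivalence.to (↑ʳ-≤ k)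
    (subst₂ F._≤_ (lookup-⊕ʳ j) (lookup-⊕ʳ j′)
      (far (k ↑ʳ j) (k ↑ʳ j′) (Equivalence.from (↑ʳ-spread k j j′) spread)))

⊕-farIncreasingPerm : ∀ {k m} {b : Vec (Fin k) k} {σ : Vec (Fin m) m} →
                      FarIncreasingPerm b → FarIncreasingPerm σ → FarIncreasingPerm (b ⊕ σ)
⊕-farIncreasingPerm {b = b} {σ} (perm-b , far-b) (perm-σ , far-σ) =
  ⊕-isPerm b σ perm-b perm-σ , ⊕-farIncreasing b σ far-b far-σ

⊕-injective : ∀ {k m} {b b′ : Vec (Fin k) k} {σ σ′ : Vec (Fin m) m} →
              b ⊕ σ ≡ b′ ⊕ σ′ → b ≡ b′ × σ ≡ σ′
⊕-injective {k} {m} {b} {b′} {σ} {σ′} eq =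
  Pointwise-≡⇒≡ (ext λ i → FP.↑ˡ-injective m _ _
    (trans (sym (lookup-⊕ˡ b σ i)) (trans (cong (λ π → lookup π (i ↑ˡ m)) eq) (lookup-⊕ˡ b′ σ′ i)))) ,
  Pointwise-≡⇒≡ (ext λ j → FP.↑ʳ-injective k _ _
    (trans (sym (lookup-⊕ʳ b σ j)) (trans (cong (λ π → lookup π (k ↑ʳ j)) eq) (lookup-⊕ʳ b′ σ′ j))))

prefix⇒⊕ : ∀ {k m} {b : Vec (Fin k) k} {π : Vec (Fin (k + m)) (k + m)} → IsPerm b → IsPerm π →
           (∀ i → lookup π (i ↑ˡ m) ≡ lookup b i ↑ˡ m) → ∃ λ σ → π ≡ b ⊕ σ
prefix⇒⊕ {k} {m} {b} {π} perm-b perm-π prefix = σ , Pointwise-≡⇒≡ (ext agree)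
  where
  -- The values of b already fill Fin k, so π takes values ≥ k after the prefix.
  rest : ∀ j → ∃ λ y → lookup π (k ↑ʳ j) ≡ k ↑ʳ y
  rest j = classify (split k m (lookup π (k ↑ʳ j))) refl
    where
    classify : ∀ {x} → Split k m x → lookup π (k ↑ʳ j) ≡ x → ∃ λ y → lookup π (k ↑ʳ j) ≡ k ↑ʳ y
    classify (right y) eq = y , eq
    classify (left v)  eq with i , bi≡v ← isPerm⇒surjective {π = b} perm-b v =
      contradiction (perm-π _ _ (trans (prefix i) (trans (cong (_↑ˡ m) bi≡v) (sym eq)))) (↑ˡ≢↑ʳ i j)
  σ : Vec (Fin m) m
  σ = V.tabulate (proj₁ ∘ rest)
  agree : ∀ x → lookup π x ≡ lookup (b ⊕ σ) x
  agree x with split k m x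
  ... | left i  = trans (prefix i) (sym (lookup-⊕ˡ b σ i))
  ... | right j = trans (proj₂ (rest j))
                    (trans (cong (k ↑ʳ_) (sym (lookup∘tabulate _ j))) (sym (lookup-⊕ʳ b σ j)))

-- The avoiders that are not b ⊕ σ with b and σ both nonempty.
blocks : (k : ℕ) → List (Vec (Fin k) k)
blocks 1 = (0F ∷ []) ∷ []
blocks 2 = (1F ∷ 0F ∷ []) ∷ []
blocks 3 = (2F ∷ 1F ∷ 0F ∷ []) ∷ (1F ∷ 2F ∷ 0F ∷ []) ∷ (2F ∷ 0F ∷ 1F ∷ []) ∷ []
blocks 4 = (1F ∷ 3F ∷ 0F ∷ 2F ∷ []) ∷ []
blocks _ = []

allFarIncreasingPerm : ∀ {k} (bs : List (Vec (Fin k) k)) →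
                       {True (All.all? farIncreasingPerm? bs)} → All FarIncreasingPerm bs
allFarIncreasingPerm _ {ok} = toWitness ok

blocks-farIncreasingPerm : ∀ k → All FarIncreasingPerm (blocks k)
blocks-farIncreasingPerm 0 = []
blocks-farIncreasingPerm 1 = allFarIncreasingPerm (blocks 1)
blocks-farIncreasingPerm 2 = allFarIncreasingPerm (blocks 2)
blocks-farIncreasingPerm 3 = allFarIncreasingPerm (blocks 3)
blocks-farIncreasingPerm 4 = allFarIncreasingPerm (blocks 4)
blocks-farIncreasingPerm (suc (suc (suc (suc (suc _))))) = []

blocks-unique : ∀ k → Unique (blocks k)
blocks-unique 0 = []
blocks-unique 1 = [] ∷ []
blocks-unique 2 = [] ∷ []
blocks-unique 3 = toWitness {a? = UniqueDec.unique? (≡-dec FP._≟_) (blocks 3)} _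
blocks-unique 4 = [] ∷ []
blocks-unique (suc (suc (suc (suc (suc _))))) = []

data Decomposition : ∀ {n} → Vec (Fin n) n → Set where
  block⊕ : ∀ {k m} {b : Vec (Fin k) k} {σ : Vec (Fin m) m} →
           b ∈ blocks k → FarIncreasingPerm σ → Decomposition (b ⊕ σ)

decomposition : ∀ k {m} {b : Vec (Fin k) k} {π : Vec (Fin (k + m)) (k + m)} → b ∈ blocks k →
                FarIncreasingPerm π → (∀ i → lookup π (i ↑ˡ m) ≡ lookup b i ↑ˡ m) → Decomposition π
decomposition k {b = b} {π} b∈ (perm , far) prefix
  with σ , refl ← prefix⇒⊕ {b = b} {π} (isPerm (All.lookup (blocks-farIncreasingPerm k) b∈)) perm prefix =
  block⊕ b∈ (⊕-isPerm⁻ʳ b σ perm , ⊕-farIncreasing⁻ʳ b σ far)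

-- If v sat at a position c ≥ g + 3, then π g ≤ π c = v ≤ π g would force g = c.
locate : ∀ {n} {π : Vec (Fin n) n} → FarIncreasingPerm π → (v g : Fin n) → v F.≤ lookup π g →
         ∃ λ c → lookup π c ≡ v × toℕ c < 3 + toℕ g
locate {π = π} (perm , far) v g v≤πg with c , πc≡v ← isPerm⇒surjective {π = π} perm v =
  c , πc≡v , ≰⇒> far-apart⇒⊥
  where
  far-apart⇒⊥ : 3 + toℕ g ≰ toℕ c
  far-apart⇒⊥ far-apart with refl ← perm g c (FP.≤-antisym (far g c far-apart)
                                              (subst (F._≤ lookup π g) (sym πc≡v) v≤πg)) =
    1+n≰n (≤-trans (m≤n+m _ 2) far-apart)

≢-below⇒≥ : ∀ {n} {x v : Fin n} → (∀ w → w F.< v → x ≢ w) → v F.≤ x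
≢-below⇒≥ {x = x} x≢ = ≮⇒≥ λ x<v → x≢ x x<v refl

apart : ∀ {n} {π : Vec (Fin n) n} {i j v} → FarIncreasingPerm π → i ≢ j → lookup π i ≡ v → lookup π j ≢ v
apart fip i≢j πi≡v πj≡v = i≢j (isPerm fip _ _ (trans πi≡v (sym πj≡v)))

-- positions-p₀p₁…: the values 0, 1, … of π sit at the positions p₀, p₁, ….
positions-12 : ∀ {n} {π : Vec (Fin (3 + n)) (3 + n)} → FarIncreasingPerm π →
               lookup π 1F ≡ 0F → lookup π 2F ≡ 1F → Decomposition π
positions-12 fip e₀ e₁
  with locate fip 2F 0F (≢-below⇒≥ λ { 0F _ → apart fip (λ ()) e₀ ; 1F _ → apart fip (λ ()) e₁
                                     ; (F.suc (F.suc _)) (s≤s (s≤s ())) })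
... | 0F , e₂ , _ = decomposition 3 (there (there (here refl))) fip λ { 0F → e₂ ; 1F → e₀ ; 2F → e₁ }
... | 1F , e₂ , _ = contradiction (trans (sym e₀) e₂) λ ()
... | 2F , e₂ , _ = contradiction (trans (sym e₁) e₂) λ ()
... | F.suc (F.suc (F.suc _)) , _ , s≤s (s≤s (s≤s ()))

positions-1 : ∀ {n} {π : Vec (Fin (2 + n)) (2 + n)} → FarIncreasingPerm π →
              lookup π 1F ≡ 0F → Decomposition π
positions-1 fip e₀
  with locate fip 1F 0F (≢-below⇒≥ λ { 0F _ → apart fip (λ ()) e₀ ; (F.suc _) (s≤s ()) })
... | 0F , e₁ , _ = decomposition 2 (here refl) fip λ { 0F → e₁ ; 1F → e₀ }
... | 1F , e₁ , _ = contradiction (trans (sym e₀) e₁) λ ()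
... | 2F , e₁ , _ = positions-12 fip e₀ e₁
... | F.suc (F.suc (F.suc _)) , _ , s≤s (s≤s (s≤s ()))

positions-21 : ∀ {n} {π : Vec (Fin (3 + n)) (3 + n)} → FarIncreasingPerm π →
               lookup π 2F ≡ 0F → lookup π 1F ≡ 1F → Decomposition π
positions-21 fip e₀ e₁
  with locate fip 2F 0F (≢-below⇒≥ λ { 0F _ → apart fip (λ ()) e₀ ; 1F _ → apart fip (λ ()) e₁
                                     ; (F.suc (F.suc _)) (s≤s (s≤s ())) })
... | 0F , e₂ , _ = decomposition 3 (here refl) fip λ { 0F → e₂ ; 1F → e₁ ; 2F → e₀ }
... | 1F , e₂ , _ = contradiction (trans (sym e₁) e₂) λ ()
... | 2F , e₂ , _ = contradiction (trans (sym e₀) e₂) λ ()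
... | F.suc (F.suc (F.suc _)) , _ , s≤s (s≤s (s≤s ()))

positions-203 : ∀ {n} {π : Vec (Fin (4 + n)) (4 + n)} → FarIncreasingPerm π →
                lookup π 2F ≡ 0F → lookup π 0F ≡ 1F → lookup π 3F ≡ 2F → Decomposition π
positions-203 fip e₀ e₁ e₂
  with locate fip 3F 1F (≢-below⇒≥ λ { 0F _ → apart fip (λ ()) e₀ ; 1F _ → apart fip (λ ()) e₁
                                     ; 2F _ → apart fip (λ ()) e₂
                                     ; (F.suc (F.suc (F.suc _))) (s≤s (s≤s (s≤s ()))) })
... | 0F , e₃ , _ = contradiction (trans (sym e₁) e₃) λ ()
... | 1F , e₃ , _ = decomposition 4 (here refl) fip λ { 0F → e₁ ; 1F → e₃ ; 2F → e₀ ; 3F → e₂ }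
... | 2F , e₃ , _ = contradiction (trans (sym e₀) e₃) λ ()
... | 3F , e₃ , _ = contradiction (trans (sym e₂) e₃) λ ()
... | F.suc (F.suc (F.suc (F.suc _))) , _ , s≤s (s≤s (s≤s (s≤s ())))

positions-20 : ∀ {n} {π : Vec (Fin (3 + n)) (3 + n)} → FarIncreasingPerm π →
               lookup π 2F ≡ 0F → lookup π 0F ≡ 1F → Decomposition π
positions-20 fip e₀ e₁
  with locate fip 2F 1F (≢-below⇒≥ λ { 0F _ → apart fip (λ ()) e₀ ; 1F _ → apart fip (λ ()) e₁
                                     ; (F.suc (F.suc _)) (s≤s (s≤s ())) })
... | 0F , e₂ , _ = contradiction (trans (sym e₁) e₂) λ ()
... | 1F , e₂ , _ = decomposition 3 (there (here refl)) fip λ { 0F → e₁ ; 1F → e₂ ; 2F → e₀ }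
... | 2F , e₂ , _ = contradiction (trans (sym e₀) e₂) λ ()
... | 3F , e₂ , _ = positions-203 fip e₀ e₁ e₂
... | F.suc (F.suc (F.suc (F.suc _))) , _ , s≤s (s≤s (s≤s (s≤s ())))

positions-2 : ∀ {n} {π : Vec (Fin (3 + n)) (3 + n)} → FarIncreasingPerm π →
              lookup π 2F ≡ 0F → Decomposition π
positions-2 fip e₀
  with locate fip 1F 0F (≢-below⇒≥ λ { 0F _ → apart fip (λ ()) e₀ ; (F.suc _) (s≤s ()) })
... | 0F , e₁ , _ = positions-20 fip e₀ e₁
... | 1F , e₁ , _ = positions-21 fip e₀ e₁
... | 2F , e₁ , _ = contradiction (trans (sym e₀) e₁) λ ()
... | F.suc (F.suc (F.suc _)) , _ , s≤s (s≤s (s≤s ()))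

firstBlock : ∀ {n} {π : Vec (Fin (suc n)) (suc n)} → FarIncreasingPerm π → Decomposition π
firstBlock fip with locate fip 0F 0F z≤n
... | 0F , e₀ , _ = decomposition 1 (here refl) fip λ { 0F → e₀ }
... | 1F , e₀ , _ = positions-1 fip e₀
... | 2F , e₀ , _ = positions-2 fip e₀
... | F.suc (F.suc (F.suc _)) , _ , s≤s (s≤s (s≤s ()))

-- The first two entries tell the blocks apart; the value is meaningful only on sums b ⊕ σ with b a block.
blockLength : ∀ {n} → Vec (Fin n) n → ℕ
blockLength (0F ∷ _)      = 1
blockLength (1F ∷ 0F ∷ _) = 2
blockLength (1F ∷ 3F ∷ _) = 4
blockLength _             = 3

blockLength-⊕ : ∀ {k m} {b : Vec (Fin k) k} (σ : Vec (Fin m) m) → b ∈ blocks k → blockLength (b ⊕ σ) ≡ k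
blockLength-⊕ {1} _ (here refl)                 = refl
blockLength-⊕ {2} _ (here refl)                 = refl
blockLength-⊕ {3} _ (here refl)                 = refl
blockLength-⊕ {3} _ (there (here refl))         = refl
blockLength-⊕ {3} _ (there (there (here refl))) = refl
blockLength-⊕ {4} _ (here refl)                 = refl

blocks-nonempty : ∀ {k} {b : Vec (Fin k) k} → b ∈ blocks k → 0 < k
blocks-nonempty {suc _} _ = s≤s z≤n

infixr 6 _⊕*_
_⊕*_ : ∀ {k m} → List (Vec (Fin k) k) → List (Vec (Fin m) m) → List (Vec (Fin (k + m)) (k + m))
_⊕*_ = L.cartesianProductWith _⊕_

⊕*-All : ∀ {k m} {P : Vec (Fin (k + m)) (k + m) → Set} {bs : List (Vec (Fin k) k)} {σs : List (Vec (Fin m) m)} →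
         (∀ {b σ} → b ∈ bs → σ ∈ σs → P (b ⊕ σ)) → All P (bs ⊕* σs)
⊕*-All {P = P} {bs} {σs} P-⊕ = All.tabulate λ π∈ →
  let _ , _ , b∈ , σ∈ , π≡b⊕σ = ∈-cartesianProductWith⁻ _⊕_ bs σs π∈ in subst P (sym π≡b⊕σ) (P-⊕ b∈ σ∈)

⊕*-unique : ∀ {k m} {bs : List (Vec (Fin k) k)} {σs : List (Vec (Fin m) m)} →
            Unique bs → Unique σs → Unique (bs ⊕* σs)
⊕*-unique = Unique.cartesianProductWith⁺ _⊕_ ⊕-injective

length-⊕* : ∀ {k m} (bs : List (Vec (Fin k) k)) (σs : List (Vec (Fin m) m)) →
            length (bs ⊕* σs) ≡ length bs * length σs
length-⊕* []       σs = refl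
length-⊕* (b ∷ bs) σs = trans (length-++ (L.map (b ⊕_) σs))
                               (cong₂ _+_ (length-map (b ⊕_) σs) (length-⊕* bs σs))

-- avoiders≥k n lists the avoiders of length k - 1 + n whose first block has length at least k.
mutual
  avoiders : ∀ n → List (Vec (Fin n) n)
  avoiders zero    = [] ∷ []
  avoiders (suc n) = blocks 1 ⊕* avoiders n L.++ avoiders≥2 n

  avoiders≥2 : ∀ n → List (Vec (Fin (1 + n)) (1 + n))
  avoiders≥2 zero    = []
  avoiders≥2 (suc n) = blocks 2 ⊕* avoiders n L.++ avoiders≥3 n

  avoiders≥3 : ∀ n → List (Vec (Fin (2 + n)) (2 + n))
  avoiders≥3 zero    = []
  avoiders≥3 (suc n) = blocks 3 ⊕* avoiders n L.++ avoiders≥4 n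

  avoiders≥4 : ∀ n → List (Vec (Fin (3 + n)) (3 + n))
  avoiders≥4 zero    = []
  avoiders≥4 (suc n) = blocks 4 ⊕* avoiders n

blocks⊕*-farIncreasingPerm : ∀ k {m} {σs : List (Vec (Fin m) m)} →
  All FarIncreasingPerm σs → All FarIncreasingPerm (blocks k ⊕* σs)
blocks⊕*-farIncreasingPerm k all-σs = ⊕*-All λ b∈ σ∈ →
  ⊕-farIncreasingPerm (All.lookup (blocks-farIncreasingPerm k) b∈) (All.lookup all-σs σ∈)

mutual
  avoiders-farIncreasingPerm : ∀ n → All FarIncreasingPerm (avoiders n)
  avoiders-farIncreasingPerm zero    = ((λ ()) , (λ ())) ∷ []
  avoiders-farIncreasingPerm (suc n) =
    All.++⁺ (blocks⊕*-farIncreasingPerm 1 (avoiders-farIncreasingPerm n)) (avoiders≥2-farIncreasingPerm n)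

  avoiders≥2-farIncreasingPerm : ∀ n → All FarIncreasingPerm (avoiders≥2 n)
  avoiders≥2-farIncreasingPerm zero    = []
  avoiders≥2-farIncreasingPerm (suc n) =
    All.++⁺ (blocks⊕*-farIncreasingPerm 2 (avoiders-farIncreasingPerm n)) (avoiders≥3-farIncreasingPerm n)

  avoiders≥3-farIncreasingPerm : ∀ n → All FarIncreasingPerm (avoiders≥3 n)
  avoiders≥3-farIncreasingPerm zero    = []
  avoiders≥3-farIncreasingPerm (suc n) =
    All.++⁺ (blocks⊕*-farIncreasingPerm 3 (avoiders-farIncreasingPerm n)) (avoiders≥4-farIncreasingPerm n)

  avoiders≥4-farIncreasingPerm : ∀ n → All FarIncreasingPerm (avoiders≥4 n)
  avoiders≥4-farIncreasingPerm zero    = []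
  avoiders≥4-farIncreasingPerm (suc n) = blocks⊕*-farIncreasingPerm 4 (avoiders-farIncreasingPerm n)

blocks⊕*-blockLength : ∀ k {m} {σs : List (Vec (Fin m) m)} → All (λ π → blockLength π ≡ k) (blocks k ⊕* σs)
blocks⊕*-blockLength k = ⊕*-All λ {_} {σ} b∈ _ → blockLength-⊕ σ b∈

blocks⊕*-disjoint : ∀ k {m} {σs : List (Vec (Fin m) m)} {πs} →
                    All (λ π → k < blockLength π) πs → Disjoint (blocks k ⊕* σs) πs
blocks⊕*-disjoint k longer (π∈ , π∈′) =
  <-irrefl (sym (All.lookup (blocks⊕*-blockLength k) π∈)) (All.lookup longer π∈′)

blocks⊕*-longer : ∀ {j} k {m} {σs : List (Vec (Fin m) m)} → j < k →
                  All (λ π → j < blockLength π) (blocks k ⊕* σs)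
blocks⊕*-longer k j<k = All.map (λ eq → subst (_ <_) (sym eq) j<k) (blocks⊕*-blockLength k)

mutual
  avoiders≥2-longer : ∀ n → All (λ π → 1 < blockLength π) (avoiders≥2 n)
  avoiders≥2-longer zero    = []
  avoiders≥2-longer (suc n) =
    All.++⁺ (blocks⊕*-longer 2 {σs = avoiders n} ≤-refl) (All.map (≤-trans (n≤1+n 2)) (avoiders≥3-longer n))

  avoiders≥3-longer : ∀ n → All (λ π → 2 < blockLength π) (avoiders≥3 n)
  avoiders≥3-longer zero    = []
  avoiders≥3-longer (suc n) =
    All.++⁺ (blocks⊕*-longer 3 {σs = avoiders n} ≤-refl) (All.map (≤-trans (n≤1+n 3)) (avoiders≥4-longer n))

  avoiders≥4-longer : ∀ n → All (λ π → 3 < blockLength π) (avoiders≥4 n)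
  avoiders≥4-longer zero    = []
  avoiders≥4-longer (suc n) = blocks⊕*-longer 4 {σs = avoiders n} ≤-refl

blocks⊕*-unique : ∀ k {m} {σs : List (Vec (Fin m) m)} → Unique σs → Unique (blocks k ⊕* σs)
blocks⊕*-unique k = ⊕*-unique (blocks-unique k)

mutual
  avoiders-unique : ∀ n → Unique (avoiders n)
  avoiders-unique zero    = [] ∷ []
  avoiders-unique (suc n) = Unique.++⁺ (blocks⊕*-unique 1 (avoiders-unique n)) (avoiders≥2-unique n)
                                       (blocks⊕*-disjoint 1 {σs = avoiders n} (avoiders≥2-longer n))

  avoiders≥2-unique : ∀ n → Unique (avoiders≥2 n)
  avoiders≥2-unique zero    = []
  avoiders≥2-unique (suc n) = Unique.++⁺ (blocks⊕*-unique 2 (avoiders-unique n)) (avoiders≥3-unique n)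
                                         (blocks⊕*-disjoint 2 {σs = avoiders n} (avoiders≥3-longer n))

  avoiders≥3-unique : ∀ n → Unique (avoiders≥3 n)
  avoiders≥3-unique zero    = []
  avoiders≥3-unique (suc n) = Unique.++⁺ (blocks⊕*-unique 3 (avoiders-unique n)) (avoiders≥4-unique n)
                                         (blocks⊕*-disjoint 3 {σs = avoiders n} (avoiders≥4-longer n))

  avoiders≥4-unique : ∀ n → Unique (avoiders≥4 n)
  avoiders≥4-unique zero    = []
  avoiders≥4-unique (suc n) = blocks⊕*-unique 4 (avoiders-unique n)

⊕-∈-avoiders : ∀ k {m} {b : Vec (Fin k) k} {σ : Vec (Fin m) m} →
               b ∈ blocks k → σ ∈ avoiders m → b ⊕ σ ∈ avoiders (k + m)
⊕-∈-avoiders 1 b∈ σ∈ = ∈-++⁺ˡ (∈-cartesianProductWith⁺ _⊕_ b∈ σ∈)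
⊕-∈-avoiders 2 {m} b∈ σ∈ =
  ∈-++⁺ʳ (blocks 1 ⊕* avoiders (1 + m)) (∈-++⁺ˡ (∈-cartesianProductWith⁺ _⊕_ b∈ σ∈))
⊕-∈-avoiders 3 {m} b∈ σ∈ =
  ∈-++⁺ʳ (blocks 1 ⊕* avoiders (2 + m)) (∈-++⁺ʳ (blocks 2 ⊕* avoiders (1 + m))
    (∈-++⁺ˡ (∈-cartesianProductWith⁺ _⊕_ b∈ σ∈)))
⊕-∈-avoiders 4 {m} b∈ σ∈ =
  ∈-++⁺ʳ (blocks 1 ⊕* avoiders (3 + m)) (∈-++⁺ʳ (blocks 2 ⊕* avoiders (2 + m))
    (∈-++⁺ʳ (blocks 3 ⊕* avoiders (1 + m)) (∈-cartesianProductWith⁺ _⊕_ b∈ σ∈)))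

farIncreasingPerm⇒∈-avoiders : ∀ n {π : Vec (Fin n) n} → FarIncreasingPerm π → π ∈ avoiders n
farIncreasingPerm⇒∈-avoiders = <-rec _ step
  where
  fromDecomposition : ∀ {n} {π : Vec (Fin n) n} → Decomposition π →
    (∀ {m} → m < n → ∀ {σ : Vec (Fin m) m} → FarIncreasingPerm σ → σ ∈ avoiders m) → π ∈ avoiders n
  fromDecomposition (block⊕ {k} {m} b∈ fip-σ) rec = ⊕-∈-avoiders k b∈ (rec (m<n+m m (blocks-nonempty b∈)) fip-σ)
  step : ∀ n → (∀ {m} → m < n → ∀ {σ : Vec (Fin m) m} → FarIncreasingPerm σ → σ ∈ avoiders m) →
         ∀ {π : Vec (Fin n) n} → FarIncreasingPerm π → π ∈ avoiders n
  step zero    _   {[]} _   = here refl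
  step (suc n) rec      fip = fromDecomposition (firstBlock fip) rec

∈-avoiders⇔ : ∀ n (π : Vec (Fin n) n) → π ∈ avoiders n ⇔ (IsPerm π × Avoids P14 π)
∈-avoiders⇔ n π = mk⇔
  (λ π∈ → let perm , far = All.lookup (avoiders-farIncreasingPerm n) π∈
          in perm , Equivalence.from (avoids⇔farIncreasing {π = π}) far)
  (λ (perm , avoid) → farIncreasingPerm⇒∈-avoiders n (perm , Equivalence.to (avoids⇔farIncreasing {π = π}) avoid))

count : ℕ → ℕ
count n = length (avoiders n)

avoiders-numAvoiders : ∀ n → NumAvoiders P14 n (count n)
avoiders-numAvoiders n = avoiders n , avoiders-unique n , ∈-avoiders⇔ n , refl

numAvoiders-unique : ∀ {k} {p : POP k} {n c c′} → NumAvoiders p n c → NumAvoiders p n c′ → c ≡ c′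
numAvoiders-unique (L , unique-L , ∈L⇔ , refl) (L′ , unique-L′ , ∈L′⇔ , refl) =
  ↭-length (∼bag⇒↭ (unique∧set⇒bag unique-L unique-L′ λ {π} → ⇔.trans (∈L⇔ π) (⇔.sym (∈L′⇔ π))))

Recurrence : (ℕ → ℕ) → Set
Recurrence a = ∀ n → a (4 + n) ≡ a (3 + n) + a (2 + n) + 3 * a (1 + n) + a n

Recurrence-resp-≗ : ∀ {a b : ℕ → ℕ} → (∀ n → a n ≡ b n) → Recurrence b → Recurrence a
Recurrence-resp-≗ a≗b rec-b n
  rewrite a≗b (4 + n) | a≗b (3 + n) | a≗b (2 + n) | a≗b (1 + n) | a≗b n = rec-b n

length-blocks⊕*-++ : ∀ k {m} (σs : List (Vec (Fin m) m)) πs →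
                     length (blocks k ⊕* σs L.++ πs) ≡ length (blocks k) * length σs + length πs
length-blocks⊕*-++ k σs πs = trans (length-++ (blocks k ⊕* σs)) (cong (_+ length πs) (length-⊕* (blocks k) σs))

count-recurrence : Recurrence count
count-recurrence n = begin
  count (4 + n)
    ≡⟨ length-blocks⊕*-++ 1 (avoiders (3 + n)) _ ⟩
  1 * c₃ + length (avoiders≥2 (3 + n))
    ≡⟨ cong (1 * c₃ +_) (length-blocks⊕*-++ 2 (avoiders (2 + n)) _) ⟩
  1 * c₃ + (1 * c₂ + length (avoiders≥3 (2 + n)))
    ≡⟨ cong (λ l → 1 * c₃ + (1 * c₂ + l)) (length-blocks⊕*-++ 3 (avoiders (1 + n)) _) ⟩
  1 * c₃ + (1 * c₂ + (3 * c₁ + length (avoiders≥4 (1 + n))))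
    ≡⟨ cong (λ l → 1 * c₃ + (1 * c₂ + (3 * c₁ + l))) (length-⊕* (blocks 4) (avoiders n)) ⟩
  1 * c₃ + (1 * c₂ + (3 * c₁ + 1 * count n))
    ≡⟨ rearrange c₃ c₂ c₁ (count n) ⟩
  c₃ + c₂ + 3 * c₁ + count n ∎
  where
  open ≡-Reasoning
  c₃ = count (3 + n)
  c₂ = count (2 + n)
  c₁ = count (1 + n)
  rearrange : ∀ x y z w → 1 * x + (1 * y + (3 * z + 1 * w)) ≡ x + y + 3 * z + w
  rearrange = ℕ-solve-∀

sumTo-zero : ∀ k (f : ℕ → ℤ) → (∀ i → i ≤ k → f i ≡ pos 0) → sumTo k f ≡ pos 0
sumTo-zero zero    f f≡0 = f≡0 0 z≤n
sumTo-zero (suc k) f f≡0 = cong₂ _+ℤ_ (sumTo-zero k f λ i i≤k → f≡0 i (m≤n⇒m≤1+n i≤k)) (f≡0 (suc k) ≤-refl)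

sumTo-last : ∀ k (f : ℕ → ℤ) → (∀ i → i < k → f i ≡ pos 0) → sumTo k f ≡ f k
sumTo-last zero    f _   = refl
sumTo-last (suc k) f f≡0 = trans (cong (_+ℤ f (suc k)) (sumTo-zero k f λ i i≤k → f≡0 i (s≤s i≤k)))
                                 (ℤ.+-identityˡ (f (suc k)))

⊛denom-4+ : ∀ (f : Series) k → (f ⊛ denom) (4 + k) ≡
  f k *ℤ denom 4 +ℤ f (1 + k) *ℤ denom 3 +ℤ f (2 + k) *ℤ denom 2 +ℤ f (3 + k) *ℤ denom 1 +ℤ f (4 + k) *ℤ denom 0
⊛denom-4+ f k =
  cong₂ _+ℤ_ (cong₂ _+ℤ_ (cong₂ _+ℤ_ (cong₂ _+ℤ_ (trans (sumTo-last k term vanishes) (coefficient 4 k))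
                                              (coefficient 3 (1 + k)))
                                    (coefficient 2 (2 + k)))
                          (coefficient 1 (3 + k)))
             (coefficient 0 (4 + k))
  where
  term : ℕ → ℤ
  term i = f i *ℤ denom (4 + k ∸ i)
  coefficient : ∀ r i → f i *ℤ denom (r + k ∸ k) ≡ f i *ℤ denom r
  coefficient r i = cong (λ d → f i *ℤ denom d) (m+n∸n≡m r k)
  vanishes : ∀ i → i < k → f i *ℤ denom (4 + k ∸ i) ≡ pos 0
  vanishes i i<k rewrite +-∸-assoc 4 (<⇒≤ i<k) with k ∸ i | m<n⇒0<n∸m i<k
  ... | suc _ | _ = ℤ.*-zeroʳ (f i)

ogf⊛denom : ∀ (a : ℕ → ℕ) → a 0 ≡ 1 → a 1 ≡ 1 → a 2 ≡ 2 → a 3 ≡ 6 → Recurrence a →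
            ∀ n → (ogf a ⊛ denom) n ≡ oneS n
ogf⊛denom a a₀ _  _  _  _ 0 rewrite a₀ = refl
ogf⊛denom a a₀ a₁ _  _  _ 1 rewrite a₀ | a₁ = refl
ogf⊛denom a a₀ a₁ a₂ _  _ 2 rewrite a₀ | a₁ | a₂ = refl
ogf⊛denom a a₀ a₁ a₂ a₃ _ 3 rewrite a₀ | a₁ | a₂ | a₃ = refl
ogf⊛denom a _ _ _ _ rec (suc (suc (suc (suc k)))) = begin
  (ogf a ⊛ denom) (4 + k)
    ≡⟨ ⊛denom-4+ (ogf a) k ⟩
  x₀ *ℤ - pos 1 +ℤ x₁ *ℤ - pos 3 +ℤ x₂ *ℤ - pos 1 +ℤ x₃ *ℤ - pos 1 +ℤ pos (a (4 + k)) *ℤ pos 1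
    ≡⟨ cong (λ x₄ → x₀ *ℤ - pos 1 +ℤ x₁ *ℤ - pos 3 +ℤ x₂ *ℤ - pos 1 +ℤ x₃ *ℤ - pos 1 +ℤ x₄ *ℤ pos 1)
            recurrenceℤ ⟩
  x₀ *ℤ - pos 1 +ℤ x₁ *ℤ - pos 3 +ℤ x₂ *ℤ - pos 1 +ℤ x₃ *ℤ - pos 1 +ℤ (x₃ +ℤ x₂ +ℤ pos 3 *ℤ x₁ +ℤ x₀) *ℤ pos 1
    ≡⟨ cancel x₀ x₁ x₂ x₃ ⟩
  pos 0 ∎
  where
  open ≡-Reasoning
  x₀ = pos (a k)
  x₁ = pos (a (1 + k))
  x₂ = pos (a (2 + k))
  x₃ = pos (a (3 + k))
  recurrenceℤ : pos (a (4 + k)) ≡ x₃ +ℤ x₂ +ℤ pos 3 *ℤ x₁ +ℤ x₀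
  recurrenceℤ = trans (cong pos (rec k))
    (trans (ℤ.pos-+ (a (3 + k) + a (2 + k) + 3 * a (1 + k)) (a k)) (cong (_+ℤ x₀)
      (trans (ℤ.pos-+ (a (3 + k) + a (2 + k)) (3 * a (1 + k))) (cong₂ _+ℤ_ (ℤ.pos-+ (a (3 + k)) (a (2 + k))) (ℤ.pos-* 3 (a (1 + k)))))))
  cancel : ∀ y₀ y₁ y₂ y₃ →
    y₀ *ℤ - pos 1 +ℤ y₁ *ℤ - pos 3 +ℤ y₂ *ℤ - pos 1 +ℤ y₃ *ℤ - pos 1 +ℤ (y₃ +ℤ y₂ +ℤ pos 3 *ℤ y₁ +ℤ y₀) *ℤ pos 1
    ≡ pos 0
  cancel = solve-∀

theorem14 : ((n : ℕ) → Σ ℕ (NumAvoiders P14 n))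
    × ((a : ℕ → ℕ) → ((n : ℕ) → NumAvoiders P14 n (a n)) →
        (a 0 ≡ 1) × (a 1 ≡ 1) × (a 2 ≡ 2) × (a 3 ≡ 6)
        × ((n : ℕ) → a (4 + n) ≡ a (3 + n) + a (2 + n) + 3 * a (1 + n) + a n)
        × ((n : ℕ) → (ogf a ⊛ denom) n ≡ oneS n))
theorem14 = (λ n → count n , avoiders-numAvoiders n) , λ a counts →
  let a≗count : ∀ n → a n ≡ count n
      a≗count n = numAvoiders-unique (counts n) (avoiders-numAvoiders n)
      recurrence = Recurrence-resp-≗ a≗count count-recurrence
  in a≗count 0 , a≗count 1 , a≗count 2 , a≗count 3 , recurrence ,
     ogf⊛denom a (a≗count 0) (a≗count 1) (a≗count 2) (a≗count 3) recurrence
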